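{- Weak bisimilarity $\approx$ is an equivalence relation on ${\sf Proc}$.
   Context: ${\sf Proc}$ is the set of data-closed canonical processes of value-passing CCS for trees; each $P\in{\sf Proc}$ of the form $G\langle\Phi\rangle$ or $G\langle\Phi\rangle\backslash I$ has a finite set of locations $|P|=|G|$ (vertices of a finite graph). Processes perform labelled transitions $P\xrightarrow[\lambda]{\delta}P'$ and multiset-labelled transitions $P\xrightarrow[\lambda]{\Delta}P'$, where $\delta$ is $\tau$ or a visible label $p:\alpha\cdot(\vec L)$ ($p$ a location, $\alpha$ an action $fv$ or $\overline fv$ with $f$ a symbol and $v$ a data value, $\vec L$ a vector of location sets), $\Delta$ a finite multiset of labels, and $\lambda:|P'|\to|P|$ a residual function. $P\xrightarrow[\lambda]{\tau^*}P'$: a sequence of zero or more $\tau$-transitions with $\lambda$ the composition of their residuals. $\widehat\Delta$: $\Delta$ with all $\tau$ removed. $P\xRightarrow[\lambda,\lambda_1,\lambda']{\widehat\Delta}P'$: $P\xrightarrow[\lambda]{\tau^*}P_1\xrightarrow[\lambda_1]{\widehat\Delta}P_1'\xrightarrow[\lambda']{\tau^*}P'$. A corresponding multiset $\widehat\Delta^c$ of a multiset $\widehat\Delta$ of visible labels is one in bijection with it such that corresponding labels $p:\alpha\cdot(\vec L)$, $q:\alpha\cdot(\vec M)$ have the same action. A localized relation is a set of triples $(P,E,Q)$ with $P,Q\in{\sf Proc}$, $E\subseteq|P|\times|Q|$; symmetric if $(P,E,Q)\in\mathcal R\Rightarrow(Q,{}^tE,P)\in\mathcal R$. A symmetric localized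 relation $\mathcal S$ is a weak bisimulation if for $(P,E,Q)\in\mathcal S$: (i) $P\xrightarrow[\lambda]{\tau}P'$ implies $Q\xrightarrow[\rho]{\tau^*}Q'$ and $(P',E',Q')\in\mathcal S$ for some $E'$ with $(p',q')\in E'\Rightarrow(\lambda(p'),\rho(q'))\in E$; (ii) $P\xrightarrow[\lambda]{\widehat\Delta}P'$ implies $Q\xRightarrow[\rho,\rho_1,\rho']{\widehat\Delta^c}Q'$ such that each $p:\alpha\cdot(\vec L)\in\widehat\Delta$ corresponds to some $q:\alpha\cdot(\vec M)$ with $(p,\rho(q))\in E$, and $(P',E',Q')\in\mathcal S$ for some $E'$ with $(p',q')\in E'\Rightarrow(\lambda(p'),\rho\rho_1\rho'(q'))\in E$. $P\approx Q$ iff $(P,E,Q)$ belongs to some weak bisimulation for some $E\subseteq|P|\times|Q|$. -}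

module Defs where

open import Data.List using (List; length; lookup)
open import Data.Fin using (Fin)
open import Data.Product using (Σ; ∃; _×_; _,_)
open import Function using (_∘_; id; flip)
open import Function.Bundles using (_↔_; Inverse)
open import Relation.Binary.PropositionalEquality using (_≡_)
open import Relation.Binary.Structures using (IsEquivalence)

-- A visible label  p : α · (L⃗)  of a process P : a location p ∈ |P|,
-- an action α (fv or f̄v), and the vector L⃗ of location sets (kept abstract).
record Label {Proc : Set} (Loc : Proc → Set) (Action : Set)
             (Ann : Proc → Set) (P : Proc) : Set where
  constructor _∶_·_
  field
    loc : Loc P
    act : Action
    ann : Ann P

-- Proc, locations |P|, actions, label annotations and both transition
-- relations (τ-transitions and τ-free multiset-labelled transitions,
-- each carrying its residual function λ : |P'| → |P|) are abstract.
record LocLTS : Set₁ where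
  field
    Proc   : Set
    Loc    : Proc → Set
    Action : Set
    Ann    : Proc → Set
    TauStep : (P P' : Proc) → (Loc P' → Loc P) → Set
    -- P —[Δ̂]→_λ P'  with Δ̂ a multiset (list up to order) of visible labels
    MStep : (P : Proc) → List (Label Loc Action Ann P) → (P' : Proc)
          → (Loc P' → Loc P) → Set

module Bisim (L : LocLTS) where
  open LocLTS L

  Lab : Proc → Set
  Lab = Label Loc Action Ann

  LRel : Proc → Proc → Set₁
  LRel P Q = Loc P → Loc Q → Set

  data TauStar : (P P' : Proc) → (Loc P' → Loc P) → Set where
    τ-refl : ∀ {P} → TauStar P P id
    τ-step : ∀ {P P₁ P' l₁ l₂} → TauStep P P₁ l₁ → TauStar P₁ P' l₂
           → TauStar P P' (l₁ ∘ l₂)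

  LocRel : Set₂
  LocRel = (P Q : Proc) → LRel P Q → Set₁

  Symmetric : LocRel → Set₁
  Symmetric S = ∀ {P Q E} → S P Q E → S Q P (flip E)

  Matches : ∀ {P Q Q₁} → LRel P Q → (Loc Q₁ → Loc Q)
          → List (Lab P) → List (Lab Q₁) → Set
  Matches E ρ Δ Δc =
    Σ (Fin (length Δ) ↔ Fin (length Δc)) λ π →
      ∀ i → Label.act (lookup Δ i) ≡ Label.act (lookup Δc (Inverse.to π i))
          × E (Label.loc (lookup Δ i)) (ρ (Label.loc (lookup Δc (Inverse.to π i))))

  record IsWeakBisimulation (S : LocRel) : Set₁ where
    field
      symmetric : Symmetric S
      tau : ∀ {P Q E} → S P Q E →
            ∀ {P' lam} → TauStep P P' lam →
            Σ Proc λ Q' → Σ (Loc Q' → Loc Q) λ ρ → TauStar Q Q' ρ ×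
              Σ (LRel P' Q') λ E' → S P' Q' E' ×
                (∀ p' q' → E' p' q' → E (lam p') (ρ q'))
      vis : ∀ {P Q E} → S P Q E →
            ∀ {Δ P' lam} → MStep P Δ P' lam →
            Σ Proc λ Q₁ → Σ (Loc Q₁ → Loc Q) λ ρ → TauStar Q Q₁ ρ ×
            Σ (List (Lab Q₁)) λ Δc → Matches E ρ Δ Δc ×
            Σ Proc λ Q₁' → Σ (Loc Q₁' → Loc Q₁) λ ρ₁ → MStep Q₁ Δc Q₁' ρ₁ ×
            Σ Proc λ Q' → Σ (Loc Q' → Loc Q₁') λ ρ' → TauStar Q₁' Q' ρ' ×
              Σ (LRel P' Q') λ E' → S P' Q' E' ×
                (∀ p' q' → E' p' q' → E (lam p') (ρ (ρ₁ (ρ' q'))))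

  _≈_ : Proc → Proc → Set₂
  P ≈ Q = Σ LocRel λ S → IsWeakBisimulation S × Σ (LRel P Q) λ E → S P Q E

module Submission where

-- The proof is the classical one, carried out for localized relations
-- over an arbitrary localized labelled transition structure.
--   * Reflexivity: the identity relation, paired with any reflexive
--     location relation, is a weak bisimulation.
--   * Symmetry: weak bisimulations are symmetric by definition, so the
--     witness of P ≈ Q, with its location relation transposed, witnesses
--     Q ≈ P.
--   * Transitivity: weak bisimulations are closed under union and under
--     relational composition (composing location relations through an
--     intermediate process).  The latter rests on two facts: a weak
--     bisimulation answers a τ*-sequence by a τ*-sequence, and action
--     correspondences (`Matches`) compose along location relations.
--     Given P ≈ Q via S₁ and Q ≈ R via S₂, the composite of S₁ ∪ S₂
--     relates P to R; the union is needed so that the composite is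
--     symmetric.

open import Defs
open import Relation.Binary.Structures using (IsEquivalence)
open import Data.List using (List)
open import Data.Product using (Σ; _×_; _,_; proj₁; proj₂)
open import Data.Sum using (_⊎_; inj₁; inj₂)
open import Function using (_∘_; id; flip)
open import Function.Bundles using (Inverse)
open import Function.Construct.Composition using (_↔-∘_)
open import Function.Construct.Identity using (↔-id)
open import Relation.Binary.PropositionalEquality using (_≡_; refl; trans)

module WeakBisimulations (L : LocLTS) where
  open LocLTS L
  open Bisim L
  open IsWeakBisimulation

  Tracks : ∀ {P Q P' Q'} → LRel P' Q' → (Loc P' → Loc P) → (Loc Q' → Loc Q)
         → LRel P Q → Set
  Tracks E' lam ρ E = ∀ p' q' → E' p' q' → E (lam p') (ρ q')

  _⨾_ : ∀ {P Q R} → LRel P Q → LRel Q R → LRel P R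
  _⨾_ {Q = Q} E₁ E₂ p r = Σ (Loc Q) λ q → E₁ p q × E₂ q r

  τ*-append : ∀ {P P₁ P₂ a b} → TauStar P P₁ a → TauStar P₁ P₂ b
            → TauStar P P₂ (a ∘ b)
  τ*-append τ-refl       s = s
  τ*-append (τ-step t r) s = τ-step t (τ*-append r s)

  τ*-simulation : ∀ {S} → IsWeakBisimulation S → ∀ {P Q E} → S P Q E →
                  ∀ {P' lam} → TauStar P P' lam →
                  Σ Proc λ Q' → Σ (Loc Q' → Loc Q) λ ρ → TauStar Q Q' ρ ×
                    Σ (LRel P' Q') λ E' → S P' Q' E' × Tracks E' lam ρ E
  τ*-simulation W {Q = Q} {E} s τ-refl = Q , id , τ-refl , E , s , λ _ _ e → e
  τ*-simulation W s (τ-step t r)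
    with W .tau s t
  ... | Q₁ , ρ₁ , ts₁ , E₁ , s₁ , tr₁
    with τ*-simulation W s₁ r
  ... | Q' , ρ₂ , ts₂ , E' , s' , tr₂ =
    Q' , ρ₁ ∘ ρ₂ , τ*-append ts₁ ts₂ , E' , s' , λ p q e → tr₁ _ _ (tr₂ p q e)

  matches-compose : ∀ {P Q R Q₁ R₁ R₂} {E₁ : LRel P Q} {E₂ : LRel Q R}
                      {E : LRel P R} {Eₐ : LRel Q₁ R₁}
                      {ρ : Loc Q₁ → Loc Q} {σ : Loc R₁ → Loc R}
                      {σ₂ : Loc R₂ → Loc R₁} {Δ : List (Lab P)}
                      {Δc : List (Lab Q₁)} {Δcc : List (Lab R₂)}
                  → (∀ p q r → E₁ p q → E₂ q r → E p r)
                  → Tracks Eₐ ρ σ E₂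
                  → Matches E₁ ρ Δ Δc → Matches Eₐ σ₂ Δc Δcc
                  → Matches E (σ ∘ σ₂) Δ Δcc
  matches-compose compose tracks (π₁ , m₁) (π₂ , m₂) =
    π₂ ↔-∘ π₁ , λ i →
      let j = Inverse.to π₁ i in
      trans (proj₁ (m₁ i)) (proj₁ (m₂ j)) ,
      compose _ _ _ (proj₂ (m₁ i)) (tracks _ _ (proj₂ (m₂ j)))

  data Identity : LocRel where
    identity : ∀ {P} {E : LRel P P} → (∀ p → E p p) → Identity P P E

  identity-bisimulation : IsWeakBisimulation Identity
  identity-bisimulation .symmetric (identity r) = identity r
  identity-bisimulation .tau (identity r) {P'} {lam} t =
    P' , lam , τ-step t τ-refl , _≡_ , identity (λ _ → refl) ,
    λ { p' .p' refl → r (lam p') }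
  identity-bisimulation .vis {P} (identity r) {Δ} {P'} {lam} m =
    P , id , τ-refl , Δ , (↔-id _ , λ _ → refl , r _) ,
    P' , lam , m , P' , id , τ-refl , _≡_ , identity (λ _ → refl) ,
    λ { p' .p' refl → r (lam p') }

  _∪_ : LocRel → LocRel → LocRel
  (S₁ ∪ S₂) P Q E = S₁ P Q E ⊎ S₂ P Q E

  union-bisimulation : ∀ {S₁ S₂} → IsWeakBisimulation S₁
                     → IsWeakBisimulation S₂ → IsWeakBisimulation (S₁ ∪ S₂)
  union-bisimulation W₁ W₂ .symmetric (inj₁ s) = inj₁ (W₁ .symmetric s)
  union-bisimulation W₁ W₂ .symmetric (inj₂ s) = inj₂ (W₂ .symmetric s)
  union-bisimulation W₁ W₂ .tau (inj₁ s) t with W₁ .tau s t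
  ... | Q' , ρ , ts , E' , s' , tr = Q' , ρ , ts , E' , inj₁ s' , tr
  union-bisimulation W₁ W₂ .tau (inj₂ s) t with W₂ .tau s t
  ... | Q' , ρ , ts , E' , s' , tr = Q' , ρ , ts , E' , inj₂ s' , tr
  union-bisimulation W₁ W₂ .vis (inj₁ s) m with W₁ .vis s m
  ... | Q₁ , ρ , ts , Δc , mt , Q₁' , ρ₁ , ms , Q' , ρ' , ts' , E' , s' , tr =
    Q₁ , ρ , ts , Δc , mt , Q₁' , ρ₁ , ms , Q' , ρ' , ts' , E' , inj₁ s' , tr
  union-bisimulation W₁ W₂ .vis (inj₂ s) m with W₂ .vis s m
  ... | Q₁ , ρ , ts , Δc , mt , Q₁' , ρ₁ , ms , Q' , ρ' , ts' , E' , s' , tr =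
    Q₁ , ρ , ts , Δc , mt , Q₁' , ρ₁ , ms , Q' , ρ' , ts' , E' , inj₂ s' , tr

  Composite : LocRel → LocRel
  Composite S P R E = Σ Proc λ Q → Σ (LRel P Q) λ E₁ → Σ (LRel Q R) λ E₂ →
    S P Q E₁ × S Q R E₂ × (∀ p q r → E₁ p q → E₂ q r → E p r)

  composite : ∀ {S P Q R} {E₁ : LRel P Q} {E₂ : LRel Q R}
            → S P Q E₁ → S Q R E₂ → Composite S P R (E₁ ⨾ E₂)
  composite s₁ s₂ = _ , _ , _ , s₁ , s₂ , λ p q r a b → q , a , b

  composite-bisimulation : ∀ {S} → IsWeakBisimulation S
                         → IsWeakBisimulation (Composite S)
  composite-bisimulation W .symmetric (Q , E₁ , E₂ , s₁ , s₂ , compose) =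
    Q , flip E₂ , flip E₁ , W .symmetric s₂ , W .symmetric s₁ ,
    λ r q p b a → compose p q r a b
  composite-bisimulation W .tau (_ , _ , _ , s₁ , s₂ , compose) t
    with W .tau s₁ t
  ... | _ , _ , tsQ , _ , s₁' , tr₁
    with τ*-simulation W s₂ tsQ
  ... | R' , σ , tsR , _ , s₂' , tr₂ =
    R' , σ , tsR , _ , composite s₁' s₂' ,
    λ { p r (q , a , b) → compose _ _ _ (tr₁ p q a) (tr₂ q r b) }
  -- Visible step: Q answers with τ* · Δc · τ*; R answers Q's leading τ*
  -- by τ*, Q's visible step by τ* · Δcc · τ*, and Q's trailing τ* by τ*.
  -- The two leading and two trailing τ*-blocks of R are concatenated.
  composite-bisimulation W .vis (_ , _ , _ , s₁ , s₂ , compose) {Δ} m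
    with W .vis s₁ m
  ... | _ , _ , tsQ , Δc , mtQ , _ , _ , msQ , _ , _ , tsQ' , _ , s₁' , tr₁
    with τ*-simulation W s₂ tsQ
  ... | _ , σ , tsR , _ , s₂a , tra
    with W .vis s₂a msQ
  ... | R₂ , σ₂ , tsR₂ , Δcc , mtR , R₂' , σ₁ , msR , _ , σ' , tsR₃ , _ , s₂b , trb
    with τ*-simulation W s₂b tsQ'
  ... | R' , σ'' , tsR₄ , _ , s₂c , trc =
    R₂ , σ ∘ σ₂ , τ*-append tsR tsR₂ , Δcc ,
    matches-compose {σ₂ = σ₂} {Δ} {Δc} {Δcc} compose tra mtQ mtR ,
    R₂' , σ₁ , msR , R' , σ' ∘ σ'' , τ*-append tsR₃ tsR₄ , _ ,
    composite s₁' s₂c ,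
    λ { p r (q , a , b) → compose _ _ _ (tr₁ p q a) (tra _ _ (trb _ _ (trc q r b))) }

proposition2 : (L : LocLTS) → IsEquivalence (Bisim._≈_ L)
proposition2 L = record
  { refl  = Identity , identity-bisimulation , _≡_ , identity (λ _ → refl)
  ; sym   = λ { (S , W , E , s) → S , W , flip E , IsWeakBisimulation.symmetric W s }
  ; trans = λ { (S₁ , W₁ , E₁ , s₁) (S₂ , W₂ , E₂ , s₂) →
      Composite (S₁ ∪ S₂) , composite-bisimulation (union-bisimulation W₁ W₂) ,
      E₁ ⨾ E₂ , composite (inj₁ s₁) (inj₂ s₂) }
  }
  where
  open WeakBisimulations L
  open Bisim L using (module IsWeakBisimulation)
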